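{- Let $G$ be a finite, connected, simple undirected graph with vertex set $V$ and edge set $E$. Let $\nu$ be the map from the set of $G$-semiorders to the set of $G$-semiorientations given by $\nu(P)=\{(u,v):\{u,v\}\in E,\ u<v \text{ in } P\}$. Then $\nu$ is bijective if and only if $G$ is a complete graph.
   Context: A semiorder is a poset isomorphic to the order on a finite set of unit closed intervals $[a,a+1]$ of $\mathbb{R}$ with $[a,a+1]<[b,b+1]$ iff $a+1<b$; a $G$-semiorder is a semiorder on the set $V$. A partial orientation is a subset $\mathcal{O}\subseteq V\times V$ with $(u,v)\in\mathcal{O}\Rightarrow\{u,v\}\in E$ and $(v,u)\notin\mathcal{O}$; edges not oriented are blank. A potential cycle for $\mathcal{O}$ is a cycle of $G$ whose blank edges can be directed to make it a directed cycle. A $G$-semiorientation is a partial orientation whose every potential cycle has strictly more blank edges than oriented edges.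
   Formalization: The unit intervals $[a,a+1]$ that define a semiorder have rational rather than real endpoints. -}

module Defs where

open import Data.Nat as ℕ using (ℕ; zero; suc; _<_)
open import Data.Nat.Properties using (_<?_)
open import Data.Fin using (Fin; zero; suc; toℕ; fromℕ<)
open import Data.Bool using (Bool; true; false; _∧_; _∨_; not; if_then_else_)
open import Data.Product using (Σ; _×_; _,_; ∃)
open import Data.Rational as ℚ using (ℚ; 1ℚ)
open import Function.Definitions using (Injective)
open import Function.Bundles using (_⇔_)
open import Relation.Nullary using (¬_; yes; no)
open import Relation.Binary.PropositionalEquality using (_≡_)

record SimpleGraph (n : ℕ) : Set where
  field
    adj    : Fin n → Fin n → Bool
    sym    : ∀ u v → adj u v ≡ adj v u
    irrefl : ∀ v → adj v v ≡ false
open SimpleGraph public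

data Walk {n : ℕ} (G : SimpleGraph n) : Fin n → Fin n → Set where
  here : ∀ {v} → Walk G v v
  step : ∀ {u w v} → adj G u w ≡ true → Walk G w v → Walk G u v

Connected : ∀ {n} → SimpleGraph n → Set
Connected G = ∀ u v → Walk G u v

Complete : ∀ {n} → SimpleGraph n → Set
Complete {n} G = ∀ (u v : Fin n) → ¬ (u ≡ v) → adj G u v ≡ true

Rel : ℕ → Set
Rel n = Fin n → Fin n → Bool

-- A semiorder on V: the poset is isomorphic to the order of a finite set of
-- unit intervals [a,a+1] with [a,a+1] < [b,b+1] iff a + 1 < b.
-- Encoded by an injective left-endpoint map f (distinct intervals).
IsSemiorder : ∀ {n} → Rel n → Set
IsSemiorder {n} R =
  Σ (Fin n → ℚ) λ f → Injective _≡_ _≡_ f ×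
    (∀ u v → (R u v ≡ true) ⇔ (f u ℚ.+ 1ℚ ℚ.< f v))

ν : ∀ {n} → SimpleGraph n → Rel n → Rel n
ν G P u v = adj G u v ∧ P u v

IsPartialOrientation : ∀ {n} → SimpleGraph n → Rel n → Set
IsPartialOrientation G O =
  ∀ u v → O u v ≡ true → (adj G u v ≡ true) × (O v u ≡ false)

next : ∀ {m} → Fin (suc m) → Fin (suc m)
next {m} i with toℕ i <? m
... | yes p = fromℕ< (ℕ.s≤s p)
... | no _  = zero

count : ∀ {k} → (Fin k → Bool) → ℕ
count {zero}  p = 0
count {suc k} p = (if p zero then 1 else 0) ℕ.+ count (λ i → p (suc i))

IsCycle : ∀ {n} → SimpleGraph n → (m : ℕ) → (Fin (3 ℕ.+ m) → Fin n) → Set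
IsCycle G m c = Injective _≡_ _≡_ c × (∀ i → adj G (c i) (c (next i)) ≡ true)

-- A cycle (with a chosen traversal direction) is potential if no oriented
-- edge points against the traversal; then the blank edges can be directed
-- along it to give a directed cycle.  Both directions are covered since
-- the reversed sequence is also a cycle.
IsPotential : ∀ {n} → Rel n → (m : ℕ) → (Fin (3 ℕ.+ m) → Fin n) → Set
IsPotential O m c = ∀ i → O (c (next i)) (c i) ≡ false

orientedCount : ∀ {n} → Rel n → (m : ℕ) → (Fin (3 ℕ.+ m) → Fin n) → ℕ
orientedCount O m c = count (λ i → O (c i) (c (next i)) ∨ O (c (next i)) (c i))

blankCount : ∀ {n} → Rel n → (m : ℕ) → (Fin (3 ℕ.+ m) → Fin n) → ℕ
blankCount O m c = count (λ i → not (O (c i) (c (next i)) ∨ O (c (next i)) (c i)))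

IsSemiorientation : ∀ {n} → SimpleGraph n → Rel n → Set
IsSemiorientation G O =
  IsPartialOrientation G O ×
  (∀ m c → IsCycle G m c → IsPotential O m c →
     orientedCount O m c < blankCount O m c)

νBijective : ∀ {n} → SimpleGraph n → Set
νBijective {n} G =
  (∀ P Q → IsSemiorder P → IsSemiorder Q →
     (∀ u v → ν G P u v ≡ ν G Q u v) → ∀ u v → P u v ≡ Q u v)
  ×
  (∀ O → IsSemiorientation G O →
     Σ (Rel n) λ P → IsSemiorder P × (∀ u v → ν G P u v ≡ O u v))

-- A semiorientation O of a complete graph is itself a semiorder: a directed path a → b → c with
-- O a c blank, or two oriented edges of a 4-cycle violating the 2+2 or 3+1 condition, would give a
-- potential cycle of length at most 4 with as many oriented as blank edges.  A finite relation that
-- is irreflexive, 2+2-free and 3+1-free has a unit-interval representation (Scott–Suppes): insert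
-- the elements one at a time along a linear extension of the trace order, each into the nonempty open
-- slot left by the constraints of the elements already placed.  Since every pair is an edge, ν is
-- then the identity on semiorders.  Conversely, if u and v are not adjacent, two semiorders that
-- differ only in whether u < v have the same image under ν.

module Submission where

open import Defs hiding (sym)
open import Data.Nat as ℕ using (ℕ; zero; suc; _+_; _*_; _<_; _≤_; _<ᵇ_; z≤n; s≤s)
open import Data.Nat.Properties as ℕ
  using (≤-refl; <-≤-trans; ≤-<-trans; <-irrefl; m≤n⇒m≤1+n; m≤m+n; +-mono-<-≤; +-mono-≤-<)
open import Data.Fin as Fin using (Fin; zero; suc; toℕ)
import Data.Fin.Properties as Fin
open import Data.Bool as Bool using (Bool; true; false; not; _∧_; _∨_; if_then_else_)
open import Data.Bool.Properties using (T-≡; ∧-zeroʳ)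
open import Data.List using (List; []; _∷_; foldr; filter; allFin; lookup)
open import Data.List.Relation.Unary.All as All using ([]; _∷_)
open import Data.List.Relation.Unary.Unique.Propositional using (Unique)
open import Data.List.Relation.Unary.AllPairs using ([]; _∷_)
open import Data.List.Membership.Propositional.Properties using (∈-filter⁺; ∈-filter⁻; ∈-allFin; ∈-lookup)
open import Data.Vec.Functional using (updateAt)
open import Data.Vec.Functional.Properties using (updateAt-updates; updateAt-minimal)
open import Data.List.Membership.Propositional using (_∈_)
open import Data.List.Relation.Unary.Any using (here; there)
open import Data.Rational as ℚ using (ℚ; 0ℚ; 1ℚ; _⊔_; _⊓_)
import Data.Rational.Properties as ℚ
open import Data.Product using (_×_; _,_; proj₁; proj₂; ∃-syntax)
open import Data.Sum using (_⊎_; inj₁; inj₂)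
open import Relation.Binary.Definitions using (tri<; tri≈; tri>)
open import Data.Empty using (⊥; ⊥-elim)
open import Relation.Nullary using (¬_; yes; no)
open import Relation.Nullary.Decidable using (_×-dec_)
open import Relation.Binary.PropositionalEquality
open import Function using (_∘_)
open import Function.Bundles using (_⇔_; mk⇔; Equivalence)
open import Function.Definitions using (Injective)

≡true⇒≢false : ∀ {b} → b ≡ true → b ≢ false
≡true⇒≢false refl ()

count-+-count-not : ∀ {k} (p : Fin k → Bool) → count p + count (λ i → not (p i)) ≡ k
count-+-count-not {zero}  p = refl
count-+-count-not {suc k} p with p zero
... | true  = cong suc (count-+-count-not (λ i → p (suc i)))
... | false = trans (ℕ.+-suc _ _) (cong suc (count-+-count-not (λ i → p (suc i))))

count≤ : ∀ {k} (p : Fin k → Bool) → count p ≤ k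
count≤ p = subst (count p ≤_) (count-+-count-not p) (m≤m+n _ _)

count-≥1 : ∀ {k} (p : Fin k → Bool) {i} → p i ≡ true → 1 ≤ count p
count-≥1 p {zero} pi rewrite pi = s≤s z≤n
count-≥1 p {suc i} pi with p zero
... | true  = s≤s z≤n
... | false = count-≥1 (λ j → p (suc j)) pi

count-≥2 : ∀ {k} (p : Fin k → Bool) {i j} → i ≢ j → p i ≡ true → p j ≡ true → 2 ≤ count p
count-≥2 p {zero}  {zero}  i≢j _  _  = ⊥-elim (i≢j refl)
count-≥2 p {zero}  {suc j} _   pi pj rewrite pi = s≤s (count-≥1 (λ l → p (suc l)) pj)
count-≥2 p {suc i} {zero}  _   pi pj rewrite pj = s≤s (count-≥1 (λ l → p (suc l)) pi)
count-≥2 p {suc i} {suc j} i≢j pi pj with p zero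
... | true  = s≤s (count-≥1 (λ l → p (suc l)) pi)
... | false = count-≥2 (λ l → p (suc l)) (i≢j ∘ cong suc) pi pj

not-antitone : ∀ {A : Set} (p q : A → Bool) → (∀ a → q a ≡ true → p a ≡ true) →
  ∀ a → not (p a) ≡ true → not (q a) ≡ true
not-antitone p q q⊆p a ¬pa with q a in qa
... | false = refl
... | true  = subst (λ b → not b ≡ true) (q⊆p a qa) ¬pa

count-mono : ∀ {k} (p q : Fin k → Bool) → (∀ i → p i ≡ true → q i ≡ true) → count p ≤ count q
count-mono {zero}  p q p⊆q = z≤n
count-mono {suc k} p q p⊆q with p zero in p0 | q zero in q0
... | true  | true  = s≤s (count-mono _ _ (p⊆q ∘ suc))
... | true  | false = ⊥-elim (≡true⇒≢false (p⊆q zero p0) q0)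
... | false | true  = m≤n⇒m≤1+n (count-mono _ _ (p⊆q ∘ suc))
... | false | false = count-mono _ _ (p⊆q ∘ suc)

count-mono-< : ∀ {k} (p q : Fin k → Bool) → (∀ i → p i ≡ true → q i ≡ true) →
  ∀ j → p j ≡ false → q j ≡ true → count p < count q
count-mono-< p q p⊆q zero    pj qj rewrite pj | qj = s≤s (count-mono _ _ (p⊆q ∘ suc))
count-mono-< p q p⊆q (suc j) pj qj with p zero in p0 | q zero in q0
... | true  | true  = s≤s (count-mono-< _ _ (p⊆q ∘ suc) j pj qj)
... | true  | false = ⊥-elim (≡true⇒≢false (p⊆q zero p0) q0)
... | false | true  = m≤n⇒m≤1+n (count-mono-< _ _ (p⊆q ∘ suc) j pj qj)
... | false | false = count-mono-< _ _ (p⊆q ∘ suc) j pj qj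

lookup-injective : ∀ {A : Set} {xs : List A} → Unique xs → Injective _≡_ _≡_ (lookup xs)
lookup-injective (x∉xs ∷ unique) {zero}  {zero}  _  = refl
lookup-injective (x∉xs ∷ unique) {zero}  {suc j} eq = ⊥-elim (All.lookup x∉xs (∈-lookup j) eq)
lookup-injective (x∉xs ∷ unique) {suc i} {zero}  eq = ⊥-elim (All.lookup x∉xs (∈-lookup i) (sym eq))
lookup-injective (x∉xs ∷ unique) {suc i} {suc j} eq = cong suc (lookup-injective unique eq)

p<p+1 : ∀ p → p ℚ.< p ℚ.+ 1ℚ
p<p+1 p = subst (ℚ._< p ℚ.+ 1ℚ) (ℚ.+-identityʳ p) (ℚ.+-monoʳ-< p (ℚ.positive⁻¹ 1ℚ))

p-1<p : ∀ p → p ℚ.- 1ℚ ℚ.< p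
p-1<p p = subst (p ℚ.- 1ℚ ℚ.<_) (ℚ.+-identityʳ p) (ℚ.+-monoʳ-< p (ℚ.negative⁻¹ (ℚ.- 1ℚ)))

⊔-lub-< : ∀ {p q r} → p ℚ.< r → q ℚ.< r → p ⊔ q ℚ.< r
⊔-lub-< {p} {q} p<r q<r with ℚ.⊔-sel p q
... | inj₁ p⊔q≡p = subst (ℚ._< _) (sym p⊔q≡p) p<r
... | inj₂ p⊔q≡q = subst (ℚ._< _) (sym p⊔q≡q) q<r

⊓-glb-< : ∀ {p q r} → r ℚ.< p → r ℚ.< q → r ℚ.< p ⊓ q
⊓-glb-< {p} {q} r<p r<q with ℚ.⊓-sel p q
... | inj₁ p⊓q≡p = subst (_ ℚ.<_) (sym p⊓q≡p) r<p
... | inj₂ p⊓q≡q = subst (_ ℚ.<_) (sym p⊓q≡q) r<q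

module _ {A : Set} (f : A → ℚ) where

  maxOver : ℚ → List A → ℚ
  maxOver b = foldr (λ x m → f x ⊔ m) b

  minOver : ℚ → List A → ℚ
  minOver b = foldr (λ x m → f x ⊓ m) b

  ≤-maxOver : ∀ {b x xs} → x ∈ xs → f x ℚ.≤ maxOver b xs
  ≤-maxOver {xs = y ∷ _} (here refl) = ℚ.p≤p⊔q (f y) _
  ≤-maxOver {xs = y ∷ _} (there x∈) = ℚ.p≤q⇒p≤r⊔q (f y) (≤-maxOver x∈)

  maxOver-< : ∀ {b u} xs → b ℚ.< u → (∀ {x} → x ∈ xs → f x ℚ.< u) → maxOver b xs ℚ.< u
  maxOver-< []       b<u _   = b<u
  maxOver-< (x ∷ xs) b<u f<u = ⊔-lub-< (f<u (here refl)) (maxOver-< xs b<u (f<u ∘ there))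

  minOver-≤ : ∀ {b x xs} → x ∈ xs → minOver b xs ℚ.≤ f x
  minOver-≤ {xs = y ∷ _} (here refl) = ℚ.p⊓q≤p (f y) _
  minOver-≤ {xs = y ∷ _} (there x∈) = ℚ.p≤q⇒r⊓p≤q (f y) (minOver-≤ x∈)

  <-minOver : ∀ {b l} xs → l ℚ.< b → (∀ {x} → x ∈ xs → l ℚ.< f x) → l ℚ.< minOver b xs
  <-minOver []       l<b _   = l<b
  <-minOver (x ∷ xs) l<b l<f = ⊓-glb-< (l<f (here refl)) (<-minOver xs l<b (l<f ∘ there))

separate : ∀ {A : Set} (lo hi : A → ℚ) (xs ys : List A) →
  (∀ {x y} → x ∈ xs → y ∈ ys → lo x ℚ.< hi y) →
  ∃[ q ] (∀ {x} → x ∈ xs → lo x ℚ.< q) × (∀ {y} → y ∈ ys → q ℚ.< hi y)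
separate lo hi xs ys lo<hi = q , below-q , above-q
  where
    b : ℚ
    b = minOver hi 0ℚ ys ℚ.- 1ℚ

    L : ℚ
    L = maxOver lo b xs

    L<hi : ∀ {y} → y ∈ ys → L ℚ.< hi y
    L<hi y∈ = maxOver-< lo xs (ℚ.<-≤-trans (p-1<p _) (minOver-≤ hi y∈)) (λ x∈ → lo<hi x∈ y∈)

    U : ℚ
    U = minOver hi (L ℚ.+ 1ℚ) ys

    dense : ∃[ q ] L ℚ.< q × q ℚ.< U
    dense = ℚ.<-dense (<-minOver hi ys (p<p+1 L) L<hi)

    q : ℚ
    q = proj₁ dense

    below-q : ∀ {x} → x ∈ xs → lo x ℚ.< q
    below-q x∈ = ℚ.≤-<-trans (≤-maxOver lo x∈) (proj₁ (proj₂ dense))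

    above-q : ∀ {y} → y ∈ ys → q ℚ.< hi y
    above-q y∈ = ℚ.<-≤-trans (proj₂ (proj₂ dense)) (minOver-≤ hi y∈)

record SemiorderAxioms {n} (R : Rel n) : Set where
  field
    irreflexive    : ∀ x → R x x ≡ false
    interval       : ∀ {a b c d} → R a b ≡ true → R c d ≡ true → R a d ≡ true ⊎ R c b ≡ true
    semitransitive : ∀ {a b c} → R a b ≡ true → R b c ≡ true → ∀ d → R a d ≡ true ⊎ R d c ≡ true

module Trace {n} {R : Rel n} (axioms : SemiorderAxioms R) where
  open SemiorderAxioms axioms

  height : Fin n → ℕ
  height x = count (λ a → R a x) + count (λ b → not (R x b))

  -- A linear extension of the trace of R: ties in height are broken by the index.
  key : Fin n → ℕ
  key x = height x * n + toℕ x

  _≺_ : Fin n → Fin n → Set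
  x ≺ y = key x < key y

  height-< : ∀ {x y} →
    (∀ a → R a x ≡ true → R a y ≡ true) → (∀ b → R y b ≡ true → R x b ≡ true) →
    (∃[ a ] R a x ≡ false × R a y ≡ true) ⊎ (∃[ b ] R y b ≡ false × R x b ≡ true) →
    height x < height y
  height-< pred⊆ succ⊇ (inj₁ (a , ¬Rax , Ray)) =
    +-mono-<-≤ (count-mono-< _ _ pred⊆ a ¬Rax Ray) (count-mono _ _ (not-antitone _ _ succ⊇))
  height-< pred⊆ succ⊇ (inj₂ (b , ¬Ryb , Rxb)) =
    +-mono-≤-< (count-mono _ _ pred⊆) (count-mono-< _ _ (not-antitone _ _ succ⊇) b (cong not Rxb) (cong not ¬Ryb))

  key<suc-height*n : ∀ x → key x < suc (height x) * n
  key<suc-height*n x = begin-strict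
    height x * n + toℕ x  <⟨ ℕ.+-monoʳ-< (height x * n) (Fin.toℕ<n x) ⟩
    height x * n + n      ≡⟨ ℕ.+-comm (height x * n) n ⟩
    suc (height x) * n    ∎
    where open ℕ.≤-Reasoning

  height<⇒≺ : ∀ {x y} → height x < height y → x ≺ y
  height<⇒≺ {x} {y} hx<hy = begin-strict
    key x               <⟨ key<suc-height*n x ⟩
    suc (height x) * n  ≤⟨ ℕ.*-monoˡ-≤ n hx<hy ⟩
    height y * n        ≤⟨ m≤m+n (height y * n) (toℕ y) ⟩
    key y               ∎
    where open ℕ.≤-Reasoning

  key-injective : ∀ {x y} → key x ≡ key y → x ≡ y
  key-injective {x} {y} kx≡ky with ℕ.<-cmp (height x) (height y)
  ... | tri< hx<hy _ _ = ⊥-elim (<-irrefl kx≡ky (height<⇒≺ hx<hy))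
  ... | tri> _ _ hy<hx = ⊥-elim (<-irrefl (sym kx≡ky) (height<⇒≺ hy<hx))
  ... | tri≈ _ hx≡hy _ = Fin.toℕ-injective (ℕ.+-cancelˡ-≡ (height x * n) _ _
        (trans kx≡ky (cong (λ h → h * n + toℕ y) (sym hx≡hy))))

  key<bound : ∀ x → key x < suc (n + n) * n
  key<bound x = <-≤-trans (key<suc-height*n x)
    (ℕ.*-monoˡ-≤ n (s≤s (ℕ.+-mono-≤ (count≤ (λ a → R a x)) (count≤ (λ b → not (R x b))))))

  ≺-by-pred : ∀ {a x y} → R a y ≡ true → R a x ≡ false → x ≺ y
  ≺-by-pred {a} {x} {y} Ray ¬Rax = height<⇒≺ (height-< pred⊆ succ⊇ (inj₁ (a , ¬Rax , Ray)))
    where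
      pred⊆ : ∀ a' → R a' x ≡ true → R a' y ≡ true
      pred⊆ a' Ra'x with interval Ra'x Ray
      ... | inj₁ Ra'y = Ra'y
      ... | inj₂ Rax  = ⊥-elim (≡true⇒≢false Rax ¬Rax)
      succ⊇ : ∀ b → R y b ≡ true → R x b ≡ true
      succ⊇ b Ryb with semitransitive Ray Ryb x
      ... | inj₁ Rax = ⊥-elim (≡true⇒≢false Rax ¬Rax)
      ... | inj₂ Rxb = Rxb

  ≺-by-succ : ∀ {b x y} → R x b ≡ true → R y b ≡ false → x ≺ y
  ≺-by-succ {b} {x} {y} Rxb ¬Ryb = height<⇒≺ (height-< pred⊆ succ⊇ (inj₂ (b , ¬Ryb , Rxb)))
    where
      pred⊆ : ∀ a → R a x ≡ true → R a y ≡ true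
      pred⊆ a Rax with semitransitive Rax Rxb y
      ... | inj₁ Ray = Ray
      ... | inj₂ Ryb = ⊥-elim (≡true⇒≢false Ryb ¬Ryb)
      succ⊇ : ∀ b' → R y b' ≡ true → R x b' ≡ true
      succ⊇ b' Ryb' with interval Rxb Ryb'
      ... | inj₁ Rxb' = Rxb'
      ... | inj₂ Ryb  = ⊥-elim (≡true⇒≢false Ryb ¬Ryb)

  R⇒≺ : ∀ {x y} → R x y ≡ true → x ≺ y
  R⇒≺ {x} Rxy = ≺-by-pred Rxy (irreflexive x)

module Representation {n} {R : Rel n} (axioms : SemiorderAxioms R) where
  open SemiorderAxioms axioms
  open Trace axioms

  record Represents (c : ℕ) (g : Fin n → ℚ) : Set where
    field
      ≺⇒<        : ∀ {x y} → key x < c → key y < c → x ≺ y → g x ℚ.< g y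
      R⇒gap      : ∀ {x y} → key x < c → key y < c → R x y ≡ true → g x ℚ.+ 1ℚ ℚ.< g y
      ¬R⇒overlap : ∀ {x y} → key x < c → key y < c → R x y ≡ false → g y ℚ.< g x ℚ.+ 1ℚ

  module Insert {c g} (rep : Represents c g) (z : Fin n) (key-z : key z ≡ c) where
    open Represents rep

    ≺z : ∀ {x} → key x < c → x ≺ z
    ≺z kx = subst (_ <_) (sym key-z) kx

    placed-or-z : ∀ {x} → key x < suc c → key x < c ⊎ x ≡ z
    placed-or-z kx with ℕ.m<1+n⇒m<n∨m≡n kx
    ... | inj₁ kx<c = inj₁ kx<c
    ... | inj₂ kx≡c = inj₂ (key-injective (trans kx≡c (sym key-z)))

    lower : Fin n → ℚ
    lower x = if R x z then g x ℚ.+ 1ℚ else g x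

    lower<upper : ∀ {x y} → key x < c → key y < c → R y z ≡ false → lower x ℚ.< g y ℚ.+ 1ℚ
    lower<upper {x} {y} kx ky ¬Ryz with R x z in Rxz
    ... | true  = ℚ.+-monoˡ-< 1ℚ (≺⇒< kx ky (≺-by-succ Rxz ¬Ryz))
    ... | false = ¬R⇒overlap ky kx ¬Ryx
      where
        -- R y x would put x above z in the trace order.
        ¬Ryx : R y x ≡ false
        ¬Ryx with R y x in Ryx
        ... | false = refl
        ... | true  = ⊥-elim (<-irrefl refl (ℕ.<-trans (≺z kx) (≺-by-pred Ryx ¬Ryz)))

    placed : List (Fin n)
    placed = filter (λ x → key x ℕ.<? c) (allFin n)

    placed⁺ : ∀ {x} → key x < c → x ∈ placed
    placed⁺ {x} kx = ∈-filter⁺ (λ x → key x ℕ.<? c) (∈-allFin x) kx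

    placed⁻ : ∀ {x} → x ∈ placed → key x < c
    placed⁻ = proj₂ ∘ ∈-filter⁻ (λ x → key x ℕ.<? c) {xs = allFin n}

    notBelow-z : List (Fin n)
    notBelow-z = filter (λ y → R y z Bool.≟ false) placed

    notBelow-z⁺ : ∀ {y} → key y < c → R y z ≡ false → y ∈ notBelow-z
    notBelow-z⁺ ky ¬Ryz = ∈-filter⁺ (λ y → R y z Bool.≟ false) (placed⁺ ky) ¬Ryz

    notBelow-z⁻ : ∀ {y} → y ∈ notBelow-z → key y < c × R y z ≡ false
    notBelow-z⁻ y∈ with ∈-filter⁻ (λ y → R y z Bool.≟ false) {xs = placed} y∈
    ... | y∈placed , ¬Ryz = placed⁻ y∈placed , ¬Ryz

    slot : ∃[ q ] (∀ {x} → key x < c → lower x ℚ.< q) ×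
                  (∀ {y} → key y < c → R y z ≡ false → q ℚ.< g y ℚ.+ 1ℚ)
    slot = from-lists (separate lower (λ y → g y ℚ.+ 1ℚ) placed notBelow-z
      (λ x∈ y∈ → let ky , ¬Ryz = notBelow-z⁻ y∈ in lower<upper (placed⁻ x∈) ky ¬Ryz))
      where
        from-lists : ∃[ q ] (∀ {x} → x ∈ placed → lower x ℚ.< q) ×
                            (∀ {y} → y ∈ notBelow-z → q ℚ.< g y ℚ.+ 1ℚ) →
                     ∃[ q ] (∀ {x} → key x < c → lower x ℚ.< q) ×
                            (∀ {y} → key y < c → R y z ≡ false → q ℚ.< g y ℚ.+ 1ℚ)
        from-lists (q , lower<q , q<upper) = q , lower<q ∘ placed⁺ , λ ky ¬Ryz → q<upper (notBelow-z⁺ ky ¬Ryz)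

    module PlaceAt (q : ℚ) (lower<q : ∀ {x} → key x < c → lower x ℚ.< q)
              (q<upper : ∀ {y} → key y < c → R y z ≡ false → q ℚ.< g y ℚ.+ 1ℚ) where

      g<q : ∀ {x} → key x < c → g x ℚ.< q
      g<q {x} kx with R x z | lower<q {x} kx
      ... | true  | g+1<q = ℚ.<-trans (p<p+1 (g x)) g+1<q
      ... | false | g<q′  = g<q′

      gap-q : ∀ {x} → key x < c → R x z ≡ true → g x ℚ.+ 1ℚ ℚ.< q
      gap-q {x} kx Rxz with lower<q {x} kx
      ... | lower<q′ rewrite Rxz = lower<q′

      g′ : Fin n → ℚ
      g′ = updateAt g z (λ _ → q)

      g′-z : g′ z ≡ q
      g′-z = updateAt-updates z g

      g′-placed : ∀ {x} → key x < c → g′ x ≡ g x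
      g′-placed {x} kx = updateAt-minimal x z g (λ { refl → <-irrefl refl (≺z kx) })

      represents : Represents (suc c) g′
      represents = record { ≺⇒< = ≺⇒<′ ; R⇒gap = R⇒gap′ ; ¬R⇒overlap = ¬R⇒overlap′ }
        where
          ≺⇒<′ : ∀ {x y} → key x < suc c → key y < suc c → x ≺ y → g′ x ℚ.< g′ y
          ≺⇒<′ kx ky x≺y with placed-or-z kx | placed-or-z ky
          ... | inj₁ kx | inj₁ ky rewrite g′-placed kx | g′-placed ky = ≺⇒< kx ky x≺y
          ... | inj₁ kx | inj₂ refl rewrite g′-placed kx | g′-z = g<q kx
          ... | inj₂ refl | inj₁ ky = ⊥-elim (<-irrefl refl (ℕ.<-trans x≺y (≺z ky)))
          ... | inj₂ refl | inj₂ refl = ⊥-elim (<-irrefl refl x≺y)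

          R⇒gap′ : ∀ {x y} → key x < suc c → key y < suc c → R x y ≡ true → g′ x ℚ.+ 1ℚ ℚ.< g′ y
          R⇒gap′ kx ky Rxy with placed-or-z kx | placed-or-z ky
          ... | inj₁ kx | inj₁ ky rewrite g′-placed kx | g′-placed ky = R⇒gap kx ky Rxy
          ... | inj₁ kx | inj₂ refl rewrite g′-placed kx | g′-z = gap-q kx Rxy
          ... | inj₂ refl | inj₁ ky = ⊥-elim (<-irrefl refl (ℕ.<-trans (R⇒≺ Rxy) (≺z ky)))
          ... | inj₂ refl | inj₂ refl = ⊥-elim (≡true⇒≢false Rxy (irreflexive z))

          ¬R⇒overlap′ : ∀ {x y} → key x < suc c → key y < suc c → R x y ≡ false → g′ y ℚ.< g′ x ℚ.+ 1ℚ
          ¬R⇒overlap′ kx ky ¬Rxy with placed-or-z kx | placed-or-z ky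
          ... | inj₁ kx | inj₁ ky rewrite g′-placed kx | g′-placed ky = ¬R⇒overlap kx ky ¬Rxy
          ... | inj₁ kx | inj₂ refl rewrite g′-placed kx | g′-z = q<upper kx ¬Rxy
          ... | inj₂ refl | inj₁ ky rewrite g′-placed ky | g′-z = ℚ.<-trans (g<q ky) (p<p+1 q)
          ... | inj₂ refl | inj₂ refl = p<p+1 (g′ z)

    extended : ∃[ g′ ] Represents (suc c) g′
    extended = g′ , represents
      where open PlaceAt (proj₁ slot) (proj₁ (proj₂ slot)) (proj₂ (proj₂ slot))

  extend : ∀ {c g} → Represents c g → ∃[ g′ ] Represents (suc c) g′
  extend {c} {g} rep with Fin.any? (λ z → key z ℕ.≟ c)
  ... | yes (z , key-z) = Insert.extended rep z key-z
  ... | no  no-key-c    = g , record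
    { ≺⇒<        = λ kx ky → ≺⇒< (below kx) (below ky)
    ; R⇒gap      = λ kx ky → R⇒gap (below kx) (below ky)
    ; ¬R⇒overlap = λ kx ky → ¬R⇒overlap (below kx) (below ky)
    }
    where
      open Represents rep
      below : ∀ {x} → key x < suc c → key x < c
      below {x} kx with ℕ.m<1+n⇒m<n∨m≡n kx
      ... | inj₁ kx<c = kx<c
      ... | inj₂ kx≡c = ⊥-elim (no-key-c (x , kx≡c))

  represent : ∀ c → ∃[ g ] Represents c g
  represent zero    = (λ _ → 0ℚ) , record { ≺⇒< = λ () ; R⇒gap = λ () ; ¬R⇒overlap = λ () }
  represent (suc c) = extend (proj₂ (represent c))

  isSemiorder : IsSemiorder R
  isSemiorder = f , f-injective , λ x y → mk⇔ (R⇒gap (key<bound x) (key<bound y)) (gap⇒R x y)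
    where
      f : Fin n → ℚ
      f = proj₁ (represent (suc (n + n) * n))
      open Represents (proj₂ (represent (suc (n + n) * n)))

      f-injective : Injective _≡_ _≡_ f
      f-injective {x} {y} fx≡fy with ℕ.<-cmp (key x) (key y)
      ... | tri< x≺y _ _ = ⊥-elim (ℚ.<-irrefl fx≡fy (≺⇒< (key<bound x) (key<bound y) x≺y))
      ... | tri≈ _ kx≡ky _ = key-injective kx≡ky
      ... | tri> _ _ y≺x = ⊥-elim (ℚ.<-irrefl (sym fx≡fy) (≺⇒< (key<bound y) (key<bound x) y≺x))

      gap⇒R : ∀ x y → f x ℚ.+ 1ℚ ℚ.< f y → R x y ≡ true
      gap⇒R x y gap with R x y in Rxy
      ... | true  = refl
      ... | false = ⊥-elim (ℚ.<-asym gap (¬R⇒overlap (key<bound x) (key<bound y) Rxy))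

SemiorderAxioms⇒IsSemiorder : ∀ {n} {R : Rel n} → SemiorderAxioms R → IsSemiorder R
SemiorderAxioms⇒IsSemiorder = Representation.isSemiorder

threshold : ∀ {n} → (Fin n → ℕ) → Rel n
threshold a x y = suc (a x) <ᵇ a y

threshold⇒< : ∀ {n} (a : Fin n → ℕ) {x y} → threshold a x y ≡ true → suc (a x) < a y
threshold⇒< a {x} {y} axy = ℕ.<ᵇ⇒< (suc (a x)) (a y) (Equivalence.from T-≡ axy)

<⇒threshold : ∀ {n} (a : Fin n → ℕ) {x y} → suc (a x) < a y → threshold a x y ≡ true
<⇒threshold a ax<ay = Equivalence.to T-≡ (ℕ.<⇒<ᵇ ax<ay)

threshold-axioms : ∀ {n} (a : Fin n → ℕ) → SemiorderAxioms (threshold a)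
threshold-axioms a = record { irreflexive = irreflexive ; interval = interval ; semitransitive = semitransitive }
  where
    irreflexive : ∀ x → threshold a x x ≡ false
    irreflexive x with threshold a x x in axx
    ... | false = refl
    ... | true  = ⊥-elim (ℕ.1+n≰n (ℕ.<⇒≤ (threshold⇒< a axx)))

    interval : ∀ {p q r s} → threshold a p q ≡ true → threshold a r s ≡ true →
      threshold a p s ≡ true ⊎ threshold a r q ≡ true
    interval {p} {q} {r} {s} pq rs with a p ℕ.≤? a r
    ... | yes ap≤ar = inj₁ (<⇒threshold a (≤-<-trans (s≤s ap≤ar) (threshold⇒< a rs)))
    ... | no  ap≰ar =
      inj₂ (<⇒threshold a (≤-<-trans (ℕ.≰⇒> ap≰ar) (ℕ.<-trans (ℕ.n<1+n _) (threshold⇒< a pq))))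

    semitransitive : ∀ {p q r} → threshold a p q ≡ true → threshold a q r ≡ true →
      ∀ d → threshold a p d ≡ true ⊎ threshold a d r ≡ true
    semitransitive {p} {q} {r} pq qr d with a q ℕ.≤? a d
    ... | yes aq≤ad = inj₁ (<⇒threshold a (<-≤-trans (threshold⇒< a pq) aq≤ad))
    ... | no  aq≰ad =
      inj₂ (<⇒threshold a (≤-<-trans (ℕ.≰⇒> aq≰ad) (ℕ.<-trans (ℕ.n<1+n _) (threshold⇒< a qr))))

threshold-isSemiorder : ∀ {n} (a : Fin n → ℕ) → IsSemiorder (threshold a)
threshold-isSemiorder a = SemiorderAxioms⇒IsSemiorder (threshold-axioms a)

module TwoSemiorders {n} {u v : Fin n} (u≢v : u ≢ v) where

  -- u at level 0, v at level k and every other vertex at level 4: for k = 1 and k = 2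
  -- the resulting semiorders differ only in whether u < v.
  level : ℕ → Fin n → ℕ
  level k x with x Fin.≟ u | x Fin.≟ v
  ... | yes _ | _     = 0
  ... | no _  | yes _ = k
  ... | no _  | no _  = 4

  Levels : Fin n → ℕ → ℕ → Set
  Levels x a₁ a₂ = level 1 x ≡ a₁ × level 2 x ≡ a₂

  levels-u : Levels u 0 0
  levels-u with u Fin.≟ u
  ... | yes _   = refl , refl
  ... | no u≢u = ⊥-elim (u≢u refl)

  levels-v : Levels v 1 2
  levels-v with v Fin.≟ u | v Fin.≟ v
  ... | yes v≡u | _      = ⊥-elim (u≢v (sym v≡u))
  ... | no _    | yes _  = refl , refl
  ... | no _    | no v≢v = ⊥-elim (v≢v refl)

  vertex-levels : ∀ x → (x ≡ u × Levels x 0 0) ⊎ (x ≡ v × Levels x 1 2) ⊎ Levels x 4 4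
  vertex-levels x with x Fin.≟ u | x Fin.≟ v
  ... | yes x≡u | _       = inj₁ (x≡u , refl , refl)
  ... | no _    | yes x≡v = inj₂ (inj₁ (x≡v , refl , refl))
  ... | no _    | no _    = inj₂ (inj₂ (refl , refl))

  P : ℕ → Rel n
  P k = threshold (level k)

  by-levels : ∀ {x y a₁ a₂ b₁ b₂} → Levels x a₁ a₂ → Levels y b₁ b₂ →
    (suc a₁ <ᵇ b₁) ≡ (suc a₂ <ᵇ b₂) → P 1 x y ≡ P 2 x y
  by-levels (refl , refl) (refl , refl) same = same

  P-agrees : ∀ x y → ¬ (x ≡ u × y ≡ v) → P 1 x y ≡ P 2 x y
  P-agrees x y not-uv with vertex-levels x | vertex-levels y
  ... | inj₁ (x≡u , _)       | inj₂ (inj₁ (y≡v , _)) = ⊥-elim (not-uv (x≡u , y≡v))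
  ... | inj₁ (_ , lx)        | inj₁ (_ , ly)        = by-levels lx ly refl
  ... | inj₁ (_ , lx)        | inj₂ (inj₂ ly)       = by-levels lx ly refl
  ... | inj₂ (inj₁ (_ , lx)) | inj₁ (_ , ly)        = by-levels lx ly refl
  ... | inj₂ (inj₁ (_ , lx)) | inj₂ (inj₁ (_ , ly)) = by-levels lx ly refl
  ... | inj₂ (inj₁ (_ , lx)) | inj₂ (inj₂ ly)       = by-levels lx ly refl
  ... | inj₂ (inj₂ lx)       | inj₁ (_ , ly)        = by-levels lx ly refl
  ... | inj₂ (inj₂ lx)       | inj₂ (inj₁ (_ , ly)) = by-levels lx ly refl
  ... | inj₂ (inj₂ lx)       | inj₂ (inj₂ ly)       = by-levels lx ly refl

  P-differ : P 1 u v ≢ P 2 u v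
  P-differ with levels-u | levels-v
  ... | l₁u , l₂u | l₁v , l₂v rewrite l₁u | l₂u | l₁v | l₂v = λ ()

nonAdjacent⇒¬νBijective : ∀ {n} (G : SimpleGraph n) {u v} → u ≢ v → adj G u v ≡ false → ¬ νBijective G
nonAdjacent⇒¬νBijective G {u} {v} u≢v ¬adj-uv (ν-injective , _) =
  P-differ (ν-injective (P 1) (P 2) (threshold-isSemiorder (level 1)) (threshold-isSemiorder (level 2)) ν-agrees u v)
  where
    open TwoSemiorders u≢v

    ν-agrees : ∀ x y → ν G (P 1) x y ≡ ν G (P 2) x y
    ν-agrees x y with x Fin.≟ u ×-dec y Fin.≟ v
    ... | yes (refl , refl) = trans (cong (_∧ P 1 u v) ¬adj-uv) (cong (_∧ P 2 u v) (sym ¬adj-uv))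
    ... | no not-uv         = cong (adj G x y ∧_) (P-agrees x y not-uv)

module Semiorientation {n} {G : SimpleGraph n} (complete : Complete G) {O : Rel n}
    (semi : IsSemiorientation G O) where

  O⇒adj : ∀ {x y} → O x y ≡ true → adj G x y ≡ true
  O⇒adj {x} {y} Oxy = proj₁ (proj₁ semi x y Oxy)

  asymmetric : ∀ {x y} → O x y ≡ true → O y x ≡ false
  asymmetric {x} {y} Oxy = proj₂ (proj₁ semi x y Oxy)

  irreflexive : ∀ x → O x x ≡ false
  irreflexive x with O x x in Oxx
  ... | false = refl
  ... | true  = ⊥-elim (≡true⇒≢false (O⇒adj Oxx) (irrefl G x))

  O⇒≢ : ∀ {x y} → O x y ≡ true → x ≢ y
  O⇒≢ {x} Oxy refl = ≡true⇒≢false Oxy (irreflexive x)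

  -- Two oriented edges are already half of a cycle of length at most 4.
  two-oriented-edges : ∀ {m c} → 3 + m ≤ 4 → IsCycle G m c → IsPotential O m c →
    ∀ {i j} → i ≢ j → O (c i) (c (next i)) ≡ true → O (c j) (c (next j)) ≡ true → ⊥
  two-oriented-edges {m} {c} short cycle potential {i} {j} i≢j Oi Oj =
    ℕ.<⇒≱ (proj₂ semi m c cycle potential) blanks≤oriented
    where
      oriented : Fin (3 + m) → Bool
      oriented k = O (c k) (c (next k)) ∨ O (c (next k)) (c k)

      oriented-if : ∀ k → O (c k) (c (next k)) ≡ true → oriented k ≡ true
      oriented-if k Ok rewrite Ok = refl

      blanks≤oriented : count (λ k → not (oriented k)) ≤ count oriented
      blanks≤oriented = ℕ.+-cancelˡ-≤ (count oriented) _ _ (begin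
        count oriented + count (λ k → not (oriented k))  ≡⟨ count-+-count-not oriented ⟩
        3 + m                                            ≤⟨ short ⟩
        2 + 2                                            ≤⟨ ℕ.+-mono-≤ two≤ two≤ ⟩
        count oriented + count oriented                  ∎)
        where
          open ℕ.≤-Reasoning
          two≤ : 2 ≤ count oriented
          two≤ = count-≥2 oriented i≢j (oriented-if i Oi) (oriented-if j Oj)

  triangle : ∀ {a b c} → a ≢ b → a ≢ c → b ≢ c → IsCycle G 0 (lookup (a ∷ b ∷ c ∷ []))
  triangle {a} {b} {c} a≢b a≢c b≢c =
    lookup-injective ((a≢b ∷ a≢c ∷ []) ∷ (b≢c ∷ []) ∷ [] ∷ []) , edge
    where
      edge : ∀ i → adj G (lookup (a ∷ b ∷ c ∷ []) i) (lookup (a ∷ b ∷ c ∷ []) (next i)) ≡ true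
      edge zero             = complete a b a≢b
      edge (suc zero)       = complete b c b≢c
      edge (suc (suc zero)) = complete c a (a≢c ∘ sym)

  square : ∀ {a b c d} → a ≢ b → a ≢ c → a ≢ d → b ≢ c → b ≢ d → c ≢ d →
    IsCycle G 1 (lookup (a ∷ b ∷ c ∷ d ∷ []))
  square {a} {b} {c} {d} a≢b a≢c a≢d b≢c b≢d c≢d =
    lookup-injective ((a≢b ∷ a≢c ∷ a≢d ∷ []) ∷ (b≢c ∷ b≢d ∷ []) ∷ (c≢d ∷ []) ∷ [] ∷ []) , edge
    where
      edge : ∀ i → adj G (lookup (a ∷ b ∷ c ∷ d ∷ []) i) (lookup (a ∷ b ∷ c ∷ d ∷ []) (next i)) ≡ true
      edge zero                   = complete a b a≢b
      edge (suc zero)             = complete b c b≢c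
      edge (suc (suc zero))       = complete c d c≢d
      edge (suc (suc (suc zero))) = complete d a (a≢d ∘ sym)

  transitive : ∀ {a b c} → O a b ≡ true → O b c ≡ true → O a c ≡ true
  transitive {a} {b} {c} Oab Obc with O a c in Oac
  ... | true  = refl
  ... | false = ⊥-elim (two-oriented-edges (ℕ.n≤1+n 3) (triangle (O⇒≢ Oab) a≢c (O⇒≢ Obc)) potential
                  {zero} {suc zero} (λ ()) Oab Obc)
    where
      a≢c : a ≢ c
      a≢c refl = ≡true⇒≢false Oab (asymmetric Obc)

      potential : IsPotential O 0 (lookup (a ∷ b ∷ c ∷ []))
      potential zero             = asymmetric Oab
      potential (suc zero)       = asymmetric Obc
      potential (suc (suc zero)) = Oac

  interval : ∀ {a b c d} → O a b ≡ true → O c d ≡ true → O a d ≡ true ⊎ O c b ≡ true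
  interval {a} {b} {c} {d} Oab Ocd with O a d in Oad | O c b in Ocb
  ... | true  | _     = inj₁ refl
  ... | false | true  = inj₂ refl
  ... | false | false = ⊥-elim (two-oriented-edges ≤-refl
                          (square (O⇒≢ Oab) a≢c a≢d b≢c b≢d (O⇒≢ Ocd)) potential
                          {zero} {suc (suc zero)} (λ ()) Oab Ocd)
    where
      a≢c : a ≢ c
      a≢c refl = ≡true⇒≢false Ocd Oad
      a≢d : a ≢ d
      a≢d refl = ≡true⇒≢false (transitive Ocd Oab) Ocb
      b≢c : b ≢ c
      b≢c refl = ≡true⇒≢false (transitive Oab Ocd) Oad
      b≢d : b ≢ d
      b≢d refl = ≡true⇒≢false Ocd Ocb

      potential : IsPotential O 1 (lookup (a ∷ b ∷ c ∷ d ∷ []))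
      potential zero                   = asymmetric Oab
      potential (suc zero)             = Ocb
      potential (suc (suc zero))       = asymmetric Ocd
      potential (suc (suc (suc zero))) = Oad

  semitransitive : ∀ {a b c} → O a b ≡ true → O b c ≡ true → ∀ d → O a d ≡ true ⊎ O d c ≡ true
  semitransitive {a} {b} {c} Oab Obc d with O a d in Oad | O d c in Odc
  ... | true  | _     = inj₁ refl
  ... | false | true  = inj₂ refl
  ... | false | false = ⊥-elim (two-oriented-edges ≤-refl
                          (square (O⇒≢ Oab) (O⇒≢ Oac) a≢d (O⇒≢ Obc) b≢d c≢d) potential
                          {zero} {suc zero} (λ ()) Oab Obc)
    where
      Oac : O a c ≡ true
      Oac = transitive Oab Obc
      a≢d : a ≢ d
      a≢d refl = ≡true⇒≢false Oac Odc
      b≢d : b ≢ d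
      b≢d refl = ≡true⇒≢false Oab Oad
      c≢d : c ≢ d
      c≢d refl = ≡true⇒≢false Oac Oad

      potential : IsPotential O 1 (lookup (a ∷ b ∷ c ∷ d ∷ []))
      potential zero                   = asymmetric Oab
      potential (suc zero)             = asymmetric Obc
      potential (suc (suc zero))       = Odc
      potential (suc (suc (suc zero))) = Oad

  semiorderAxioms : SemiorderAxioms O
  semiorderAxioms = record
    { irreflexive = irreflexive ; interval = interval ; semitransitive = semitransitive }

  ν-fixes : ∀ x y → ν G O x y ≡ O x y
  ν-fixes x y with O x y in Oxy
  ... | true  rewrite O⇒adj Oxy = refl
  ... | false = ∧-zeroʳ (adj G x y)

semiorder-irreflexive : ∀ {n} {P : Rel n} → IsSemiorder P → ∀ x → P x x ≡ false
semiorder-irreflexive {P = P} (f , _ , P⇔gap) x with P x x in Pxx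
... | false = refl
... | true  = ⊥-elim (ℚ.<-asym (Equivalence.to (P⇔gap x x) Pxx) (p<p+1 (f x)))

Complete⇒νBijective : ∀ {n} (G : SimpleGraph n) → Complete G → νBijective G
Complete⇒νBijective G complete = ν-injective , ν-surjective
  where
    ν-injective : ∀ P Q → IsSemiorder P → IsSemiorder Q →
      (∀ x y → ν G P x y ≡ ν G Q x y) → ∀ x y → P x y ≡ Q x y
    ν-injective P Q P-semi Q-semi νP≡νQ x y with x Fin.≟ y
    ... | yes refl = trans (semiorder-irreflexive P-semi x) (sym (semiorder-irreflexive Q-semi x))
    ... | no  x≢y  = subst (λ e → e ∧ P x y ≡ e ∧ Q x y) (complete x y x≢y) (νP≡νQ x y)

    ν-surjective : ∀ O → IsSemiorientation G O → ∃[ P ] IsSemiorder P × (∀ x y → ν G P x y ≡ O x y)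
    ν-surjective O semi = O , SemiorderAxioms⇒IsSemiorder semiorderAxioms , ν-fixes
      where open Semiorientation {G = G} complete semi

νBijective⇒Complete : ∀ {n} (G : SimpleGraph n) → νBijective G → Complete G
νBijective⇒Complete G bijective u v u≢v with adj G u v in adj-uv
... | true  = refl
... | false = ⊥-elim (nonAdjacent⇒¬νBijective G u≢v adj-uv bijective)

theorem3p11 : (n : ℕ) (G : SimpleGraph n) → Connected G →
    νBijective G ⇔ Complete G
theorem3p11 n G _ = mk⇔ (νBijective⇒Complete G) (Complete⇒νBijective G)
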